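{- Let $h\geq 3$ and $k\geq 3h+3$ be positive integers, and let $A=[0,k+1]\setminus\{x,k\}$ with $x\in[1,k-3]$. (i) If $x\in[1,h-1]$, then $|h^{\wedge}A| = hk-h^2+x+2$. (ii) If $x\in\{h,k-h\}$, then $|h^{\wedge}A| = hk-h^2+h+1$. (iii) If $x\in[h+1,k-h-1]$, then $|h^{\wedge}A| = hk-h^2+h+2$. (iv) If $x\in[k-(h-1),k-3]$, then $|h^{\wedge}A| = (h+1)k-h^2-x+2$.
   Context: For a finite set $A$ of integers and a positive integer $h\le |A|$, the restricted $h$-fold sumset $h^{\wedge}A$ is the set of all sums of $h$ distinct elements of $A$. For integers $\alpha\le\beta$, $[\alpha,\beta]=\{x\in\mathbb{Z}:\alpha\le x\le\beta\}$ (empty if $\alpha>\beta$). -}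

module Defs where

open import Data.Nat using (ℕ; _≤_; _+_; suc)
open import Data.List using (List; length)
open import Data.Nat.ListAction using (sum)
open import Data.List.Relation.Unary.All using (All)
open import Data.List.Relation.Unary.Unique.Propositional using (Unique)
open import Data.List.Membership.Propositional using (_∈_)
open import Data.Product using (_×_; ∃-syntax)
open import Function.Bundles using (_⇔_)
open import Relation.Binary.PropositionalEquality using (_≡_; _≢_)

NSet : Set₁
NSet = ℕ → Set

Aset : ℕ → ℕ → NSet
Aset k x y = (y ≤ k + 1) × (y ≢ x) × (y ≢ k)

RestrictedSumset : ℕ → NSet → NSet
RestrictedSumset h A n =
  ∃[ l ] ((length l ≡ h) × Unique l × All A l × (sum l ≡ n))

HasCard : NSet → ℕ → Set
HasCard S m = ∃[ l ] (Unique l × (∀ n → (n ∈ l ⇔ S n)) × (length l ≡ m))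

-- Write h = g + 1 and k = x + n₂ + 1, so that A = B ∪ {k + 1} with B = [0, x + n₂] ∖ {x}: an
-- element of h^A is a sum of h elements of B, or k + 1 plus a sum of g elements of B.  Choosing
-- j elements of [0, x) and i elements of (x, x + n₂] realises every value between the least and
-- the greatest such sum, and moving one element from the left block to the right one gives an
-- interval that overlaps or abuts the previous one; so does adding k + 1.  Chaining these
-- intervals covers everything from T h + (h ∸ x) to k + 1 + g (x + n₂) − T g − (g ∸ n₂), where
-- T n = 0 + 1 + ⋯ + (n − 1), except T h + 1 when x = h and the second largest value when n₂ = g,
-- i.e. x = k − h.  Nothing else is a sum: n distinct naturals other than x add up to at least
-- T n + (n ∸ x), the reflection y ↦ x + n₂ ∸ y turns this into the upper bound, and the two
-- missing values are excluded in the same way.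

module Submission where

open import Defs
open import Data.Nat using (ℕ; _≤_; _+_; _*_; _∸_)
open import Data.Product using (_×_)
open import Data.Sum using (_⊎_)
open import Relation.Binary.PropositionalEquality using (_≡_)

open import Data.Nat using (zero; suc; pred; z<s; _<_; z≤n; s≤s; _≤?_; _<?_; _≟_)
open import Data.Nat.Properties
open import Data.Nat.ListAction using (sum)
open import Data.Nat.ListAction.Properties using (sum-↭; sum-++)
open import Data.Nat.Tactic.RingSolver using (solve-∀)
open import Data.List using (List; []; _∷_; _++_; length; map; applyUpTo)
open import Data.List.Properties using (length-map; length-++; length-applyUpTo)
open import Data.List.Relation.Unary.All as All using (All; []; _∷_)
open import Data.List.Relation.Unary.All.Properties using (¬All⇒Any¬; map⁺; ++⁺)
open import Data.List.Relation.Unary.Unique.Propositional using (Unique; []; _∷_)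
import Data.List.Relation.Unary.Unique.Propositional.Properties as Unique
open import Data.List.Membership.Propositional using (_∈_; find)
open import Data.List.Membership.Propositional.Properties
  using (∈-∃++; ∈-applyUpTo⁺; ∈-applyUpTo⁻; ∈-++⁺ˡ; ∈-++⁺ʳ; ∈-++⁻)
open import Data.List.Membership.DecPropositional _≟_ using (_∈?_)
open import Data.List.Relation.Binary.Permutation.Propositional using (_↭_; ↭⇒↭ₛ)
open import Data.List.Relation.Binary.Permutation.Propositional.Properties
  using (shift; ↭-length; All-resp-↭)
open import Data.Product using (_,_; proj₁; proj₂; ∃-syntax)
open import Data.Sum using (inj₁; inj₂; [_,_]′)
import Data.Sum as Sum
open import Data.Empty using (⊥-elim)
open import Function using (_∘_)
open import Function.Bundles using (_⇔_; mk⇔; Equivalence)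
open import Relation.Nullary using (¬_; yes; no)
open import Relation.Binary.PropositionalEquality
  using (refl; sym; trans; cong; cong₂; subst; subst₂; ≢-sym; setoid; _≢_; module ≡-Reasoning)
open import Data.List.Relation.Binary.Permutation.Setoid.Properties (setoid ℕ)
  using (Unique-resp-↭)

-- Triangular numbers

triangle : ℕ → ℕ
triangle zero    = 0
triangle (suc n) = n + triangle n

triangle-+ : ∀ m n → triangle (m + n) ≡ triangle m + triangle n + m * n
triangle-+ zero    n = sym (+-identityʳ (triangle n))
triangle-+ (suc m) n = begin
  m + n + triangle (m + n)                  ≡⟨ cong (m + n +_) (triangle-+ m n) ⟩
  m + n + (triangle m + triangle n + m * n) ≡⟨ rearrange m n (triangle m) (triangle n) ⟩
  m + triangle m + triangle n + suc m * n   ∎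
  where
  open ≡-Reasoning
  rearrange : ∀ m n a b → m + n + (a + b + m * n) ≡ m + a + b + suc m * n
  rearrange = solve-∀

triangle-double : ∀ n → triangle n + triangle n + n ≡ n * n
triangle-double zero    = refl
triangle-double (suc n) = begin
  n + triangle n + (n + triangle n) + suc n ≡⟨ rearrange n (triangle n) ⟩
  triangle n + triangle n + n + (n + n + 1) ≡⟨ cong (_+ (n + n + 1)) (triangle-double n) ⟩
  n * n + (n + n + 1)                       ≡⟨ square-suc n ⟩
  suc n * suc n                             ∎
  where
  open ≡-Reasoning
  rearrange : ∀ n t → n + t + (n + t) + suc n ≡ t + t + n + (n + n + 1)
  rearrange = solve-∀
  square-suc : ∀ n → n * n + (n + n + 1) ≡ suc n * suc n
  square-suc = solve-∀

triangle-double-pred : ∀ n → triangle n + triangle n ≡ n * pred n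
triangle-double-pred zero    = refl
triangle-double-pred (suc m) = +-cancelʳ-≡ (suc m) _ _ (begin
  triangle (suc m) + triangle (suc m) + suc m ≡⟨ triangle-double (suc m) ⟩
  suc m * suc m                               ≡⟨ *-suc (suc m) m ⟩
  suc m + suc m * m                           ≡⟨ +-comm (suc m) _ ⟩
  suc m * m + suc m                           ∎)
  where open ≡-Reasoning

m+o≡n⇒m≤n : ∀ {m n} e → m + e ≡ n → m ≤ n
m+o≡n⇒m≤n {m} e refl = m≤m+n m e

m+e≡r+n⇒m∸n+e≡r : ∀ {m n e r} → n ≤ m → m + e ≡ r + n → m ∸ n + e ≡ r
m+e≡r+n⇒m∸n+e≡r {m} {n} {e} {r} n≤m m+e≡ = +-cancelʳ-≡ n _ _ (begin
  m ∸ n + e + n   ≡⟨ +-assoc (m ∸ n) e n ⟩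
  m ∸ n + (e + n) ≡⟨ cong (m ∸ n +_) (+-comm e n) ⟩
  m ∸ n + (n + e) ≡⟨ sym (+-assoc (m ∸ n) n e) ⟩
  m ∸ n + n + e   ≡⟨ cong (_+ e) (m∸n+n≡m n≤m) ⟩
  m + e           ≡⟨ m+e≡ ⟩
  r + n           ∎)
  where open ≡-Reasoning

-- Sums of distinct naturals

elements-≤-sum : ∀ l → All (_≤ sum l) l
elements-≤-sum []      = []
elements-≤-sum (y ∷ l) =
  m≤m+n y (sum l) ∷ All.map (λ {z} z≤ → ≤-trans z≤ (m≤n+m (sum l) y)) (elements-≤-sum l)

∈⇒↭∷ : ∀ {v : ℕ} {l} → v ∈ l → ∃[ r ] (l ↭ v ∷ r)
∈⇒↭∷ v∈l with ∈-∃++ v∈l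
... | ys , zs , refl = ys ++ zs , shift _ ys zs

unique-↭ : ∀ {l r : List ℕ} → l ↭ r → Unique l → Unique r
unique-↭ p = Unique-resp-↭ (↭⇒↭ₛ p)

private
  lower-bound-step : ∀ {x n b s} → n ≤ b → (x ≤ n → n < b) → triangle n + (n ∸ x) ≤ s →
    triangle (suc n) + (suc n ∸ x) ≤ b + s
  lower-bound-step {x} {n} {b} {s} n≤b x≤n⇒n<b bound with x ≤? n
  ... | yes x≤n rewrite +-∸-assoc 1 x≤n =
    subst (_≤ b + s) (rearrange n (triangle n) (n ∸ x)) (+-mono-≤ (x≤n⇒n<b x≤n) bound)
    where
    rearrange : ∀ n t d → suc n + (t + d) ≡ n + t + (1 + d)
    rearrange = solve-∀
  ... | no  x≰n rewrite m≤n⇒m∸n≡0 (≰⇒> x≰n) | +-identityʳ (n + triangle n) =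
    +-mono-≤ n≤b (≤-trans (m≤m+n (triangle n) (n ∸ x)) bound)

  -- The two length bounds are the pigeonhole principle needed in the inductive step.
  bounded-sum-lower-bound : ∀ B x {l} → All (_< B) l → Unique l → All (_≢ x) l →
    length l ≤ B × (x < length l → length l < B) × triangle (length l) + (length l ∸ x) ≤ sum l
  bounded-sum-lower-bound zero    x []       _ _ = z≤n , (λ ()) , ≤-reflexive (0∸n≡0 x)
  bounded-sum-lower-bound zero    x (() ∷ _) _ _
  bounded-sum-lower-bound (suc b) x {l} l<B u l≢x with b ∈? l
  ... | no b∉l =
    let n≤b , x<n⇒n<b , bound = bounded-sum-lower-bound b x (All.tabulate below-b) u l≢x
    in m≤n⇒m≤1+n n≤b , m≤n⇒m≤1+n ∘ x<n⇒n<b , bound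
    where
    below-b : ∀ {y} → y ∈ l → y < b
    below-b y∈l = ≤∧≢⇒< (≤-pred (All.lookup l<B y∈l)) λ y≡b → b∉l (subst (_∈ l) y≡b y∈l)
  ... | yes b∈l with ∈⇒↭∷ b∈l
  ...   | r , l↭ rewrite ↭-length l↭ | sum-↭ l↭
    with All-resp-↭ l↭ l<B | unique-↭ l↭ u | All-resp-↭ l↭ l≢x
  ...     | _ ∷ r<1+b | b∉r ∷ ur | b≢x ∷ r≢x =
    let n≤b , x<n⇒n<b , bound = bounded-sum-lower-bound b x r<b ur r≢x
        x≤n⇒n<b = λ x≤n → [ x<n⇒n<b
                            , (λ x≡n → ≤∧≢⇒< n≤b λ n≡b → b≢x (trans (sym n≡b) (sym x≡n)))
                            ]′ (m≤n⇒m<n∨m≡n x≤n)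
    in s≤s n≤b , s≤s ∘ x≤n⇒n<b ∘ ≤-pred , lower-bound-step n≤b x≤n⇒n<b bound
    where
    r<b : All (_< b) r
    r<b = All.zipWith (λ (y<1+b , b≢y) → ≤∧≢⇒< (≤-pred y<1+b) (≢-sym b≢y)) (r<1+b , b∉r)

sum-lower-bound : ∀ x {l} → Unique l → All (_≢ x) l → triangle (length l) + (length l ∸ x) ≤ sum l
sum-lower-bound x {l} u l≢x =
  proj₂ (proj₂ (bounded-sum-lower-bound (suc (sum l)) x (All.map s≤s (elements-≤-sum l)) u l≢x))

triangle-≤-sum : ∀ {l} → Unique l → triangle (length l) ≤ sum l
triangle-≤-sum {l} u = ≤-trans (m≤m+n _ _) (sum-lower-bound (suc (sum l)) u
  (All.map (λ y≤s y≡ → 1+n≰n (subst (_≤ sum l) y≡ y≤s)) (elements-≤-sum l)))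

reflect-sum : ∀ c {l} → All (_≤ c) l → sum (map (c ∸_) l) + sum l ≡ length l * c
reflect-sum c []                 = refl
reflect-sum c {y ∷ l} (y≤c ∷ l≤c) = begin
  c ∸ y + sum (map (c ∸_) l) + (y + sum l) ≡⟨ rearrange (c ∸ y) y (sum (map (c ∸_) l)) (sum l) ⟩
  (c ∸ y + y) + (sum (map (c ∸_) l) + sum l) ≡⟨ cong₂ _+_ (m∸n+n≡m y≤c) (reflect-sum c l≤c) ⟩
  c + length l * c                          ∎
  where
  open ≡-Reasoning
  rearrange : ∀ a y s t → a + s + (y + t) ≡ (a + y) + (s + t)
  rearrange = solve-∀

reflect-unique : ∀ c {l} → All (_≤ c) l → Unique l → Unique (map (c ∸_) l)
reflect-unique c []          []         = []
reflect-unique c (y≤c ∷ l≤c) (y∉l ∷ u) =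
  map⁺ (All.zipWith (λ (z≤c , y≢z) eq → y≢z (∸-cancelˡ-≡ y≤c z≤c eq)) (l≤c , y∉l))
  ∷ reflect-unique c l≤c u

reflect-avoids : ∀ c {x l} → x ≤ c → All (_≤ c) l → All (_≢ x) l → All (_≢ c ∸ x) (map (c ∸_) l)
reflect-avoids c x≤c l≤c l≢x =
  map⁺ (All.zipWith (λ (y≤c , y≢x) eq → y≢x (∸-cancelˡ-≡ y≤c x≤c eq)) (l≤c , l≢x))

sum-upper-bound : ∀ c x {l} → x ≤ c → All (_≤ c) l → Unique l → All (_≢ x) l →
  sum l + (triangle (length l) + (length l ∸ (c ∸ x))) ≤ length l * c
sum-upper-bound c x {l} x≤c l≤c u l≢x = begin
  sum l + (triangle (length l) + (length l ∸ (c ∸ x)))  ≤⟨ +-monoʳ-≤ (sum l) reflected-bound ⟩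
  sum l + sum (map (c ∸_) l)                            ≡⟨ +-comm (sum l) _ ⟩
  sum (map (c ∸_) l) + sum l                            ≡⟨ reflect-sum c l≤c ⟩
  length l * c                                          ∎
  where
  open ≤-Reasoning
  reflected-bound : triangle (length l) + (length l ∸ (c ∸ x)) ≤ sum (map (c ∸_) l)
  reflected-bound = subst (λ n → triangle n + (n ∸ (c ∸ x)) ≤ sum (map (c ∸_) l)) (length-map (c ∸_) l)
    (sum-lower-bound (c ∸ x) (reflect-unique c l≤c u) (reflect-avoids c x≤c l≤c l≢x))

sum-of-elements-below-length : ∀ {l} → Unique l → All (_< length l) l → sum l ≤ triangle (length l)
sum-of-elements-below-length {l} u l<n = +-cancelˡ-≤ (triangle n) _ _ (begin
  triangle n + sum l                  ≤⟨ +-monoˡ-≤ (sum l) reflected-bound ⟩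
  sum (map (pred n ∸_) l) + sum l     ≡⟨ reflect-sum (pred n) l≤ ⟩
  n * pred n                          ≡⟨ sym (triangle-double-pred n) ⟩
  triangle n + triangle n             ∎)
  where
  open ≤-Reasoning
  n = length l
  l≤ : All (_≤ pred n) l
  l≤ = All.map <⇒≤pred l<n
  reflected-bound : triangle n ≤ sum (map (pred n ∸_) l)
  reflected-bound = subst (λ m → triangle m ≤ sum (map (pred n ∸_) l)) (length-map (pred n ∸_) l)
    (triangle-≤-sum (reflect-unique (pred n) l≤ u))

sum-with-large-element : ∀ {l y} → Unique l → y ∈ l → length l < y → suc (suc (triangle (length l))) ≤ sum l
sum-with-large-element {l} {y} u y∈l n<y with ∈⇒↭∷ y∈l
... | r , l↭ with unique-↭ l↭ u
...   | _ ∷ ur = begin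
  suc (suc (triangle (length l)))             ≡⟨ cong (suc ∘ suc ∘ triangle) (↭-length l↭) ⟩
  suc (suc (length r)) + triangle (length r)  ≤⟨ +-mono-≤ (subst (_< y) (↭-length l↭) n<y) (triangle-≤-sum ur) ⟩
  y + sum r                                   ≡⟨ sum-↭ l↭ ⟨
  sum l                                       ∎
  where open ≤-Reasoning

sum≢suc-triangle : ∀ {l} → Unique l → All (_≢ length l) l → sum l ≢ suc (triangle (length l))
sum≢suc-triangle {l} u l≢n sum≡ with All.all? (_<? length l) l
... | yes l<n = 1+n≰n (subst (_≤ triangle (length l)) sum≡ (sum-of-elements-below-length u l<n))
... | no l≮n with find (¬All⇒Any¬ (_<? length l) l l≮n)
...   | y , y∈l , y≮n = 1+n≰n (subst (suc (suc (triangle (length l))) ≤_) sum≡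
  (sum-with-large-element u y∈l (≤∧≢⇒< (≮⇒≥ y≮n) (≢-sym (All.lookup l≢n y∈l)))))

-- Realising sums

sumset-mono : ∀ {m P Q v} → (∀ {y} → P y → Q y) → RestrictedSumset m P v → RestrictedSumset m Q v
sumset-mono P⊆Q (l , len , u , l∈P , sum≡) = l , len , u , All.map P⊆Q l∈P , sum≡

sumset-∷ : ∀ {m P y v} → ¬ P y → RestrictedSumset m P v → RestrictedSumset (suc m) (λ z → z ≡ y ⊎ P z) (y + v)
sumset-∷ {P = P} ¬Py (l , len , u , l∈P , refl) =
  _ ∷ l , cong suc len , All.map (λ Pz y≡z → ¬Py (subst P (sym y≡z) Pz)) l∈P ∷ u ,
  inj₁ refl ∷ All.map inj₂ l∈P , refl

sumset-++ : ∀ {m n P Q u w} → (∀ {y} → P y → ¬ Q y) →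
  RestrictedSumset m P u → RestrictedSumset n Q w → RestrictedSumset (m + n) (λ y → P y ⊎ Q y) (u + w)
sumset-++ P∩Q=∅ (l₁ , len₁ , u₁ , l₁∈P , sum₁) (l₂ , len₂ , u₂ , l₂∈Q , sum₂) =
  l₁ ++ l₂ , trans (length-++ l₁) (cong₂ _+_ len₁ len₂) ,
  Unique.++⁺ u₁ u₂ (λ (y∈l₁ , y∈l₂) → P∩Q=∅ (All.lookup l₁∈P y∈l₁) (All.lookup l₂∈Q y∈l₂)) ,
  ++⁺ (All.map inj₁ l₁∈P) (All.map inj₂ l₂∈Q) , trans (sum-++ l₁ l₂) (cong₂ _+_ sum₁ sum₂)

greedy-split : ∀ {w₁ w₂ t} → t ≤ w₁ + w₂ →
  ∃[ t₁ ] ∃[ t₂ ] (t₁ ≤ w₁ × t₂ ≤ w₂ × t₁ + t₂ ≡ t × (t₁ ≡ w₁ ⊎ t₂ ≡ 0))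
greedy-split {w₁} {t = t} t≤ with t ≤? w₁
... | yes t≤w₁ = t , 0 , t≤w₁ , z≤n , +-identityʳ t , inj₂ refl
... | no  t≰w₁ =
  w₁ , t ∸ w₁ , ≤-refl , m≤n+o⇒m∸n≤o t w₁ t≤ , m+[n∸m]≡n (<⇒≤ (≰⇒> t≰w₁)) , inj₁ refl

Interval : ℕ → ℕ → NSet
Interval a n y = a ≤ y × y < a + n

-- The largest element is a + m + s and the others lie in [a, a + m + s) with excess e ≤ m * s.
interval-sumset : ∀ a m d t → t ≤ m * d → RestrictedSumset m (Interval a (m + d)) (m * a + triangle m + t)
interval-sumset a zero    d zero _  = [] , refl , [] , [] , refl
interval-sumset a (suc m) d t    t≤ with greedy-split {d} {m * d} t≤
... | s , e , s≤d , e≤md , refl , greedy =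
  subst (RestrictedSumset (suc m) (Interval a (suc m + d))) (rearrange a m s e (triangle m))
    (sumset-mono widen (sumset-∷ top∉ (interval-sumset a m s e e≤ms)))
  where
  e≤ms : e ≤ m * s
  e≤ms = [ (λ s≡d → subst (λ z → e ≤ m * z) (sym s≡d) e≤md)
         , (λ e≡0 → subst (_≤ m * s) (sym e≡0) z≤n)
         ]′ greedy
  top∉ : ¬ Interval a (m + s) (a + m + s)
  top∉ (_ , top<) = <-irrefl (+-assoc a m s) top<
  grow : a + (m + s) < a + (suc m + d)
  grow = +-monoʳ-< a (s≤s (+-monoʳ-≤ m s≤d))
  widen : ∀ {z} → z ≡ a + m + s ⊎ Interval a (m + s) z → Interval a (suc m + d) z
  widen (inj₁ refl)       =
    ≤-trans (m≤m+n a m) (m≤m+n (a + m) s) , subst (_< a + (suc m + d)) (sym (+-assoc a m s)) grow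
  widen (inj₂ (a≤z , z<)) = a≤z , <-trans z< grow
  rearrange : ∀ a m s e t → a + m + s + (m * a + t + e) ≡ suc m * a + (m + t) + (s + e)
  rearrange = solve-∀

-- The least and the greatest sum of j elements of [0, x) and i elements of (x, x + n₂].
splitMin : ℕ → ℕ → ℕ → ℕ
splitMin x j i = triangle j + (i * suc x + triangle i)

splitMax : ℕ → ℕ → ℕ → ℕ → ℕ
splitMax x n₂ j i = splitMin x j i + (j * (x ∸ j) + i * (n₂ ∸ i))

Punctured : ℕ → ℕ → NSet
Punctured x n₂ y = y ≤ x + n₂ × y ≢ x

split-sumset : ∀ {x n₂ j i v} → j ≤ x → i ≤ n₂ → splitMin x j i ≤ v → v ≤ splitMax x n₂ j i →
  RestrictedSumset (j + i) (Punctured x n₂) v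
split-sumset {x} {n₂} {j} {i} {v} j≤x i≤n₂ min≤v v≤max
  with greedy-split (m≤n+o⇒m∸n≤o v (splitMin x j i) v≤max)
... | t₁ , t₂ , t₁≤ , t₂≤ , t₁+t₂≡ , _ =
  subst (RestrictedSumset (j + i) (Punctured x n₂)) sum≡
    (sumset-mono into (sumset-++ left∩right=∅
      (interval-sumset 0 j (x ∸ j) t₁ t₁≤) (interval-sumset (suc x) i (n₂ ∸ i) t₂ t₂≤)))
  where
  left-end : 0 + (j + (x ∸ j)) ≡ x
  left-end = m+[n∸m]≡n j≤x
  right-end : suc x + (i + (n₂ ∸ i)) ≡ suc (x + n₂)
  right-end = cong (suc x +_) (m+[n∸m]≡n i≤n₂)
  left∩right=∅ : ∀ {y} → Interval 0 (j + (x ∸ j)) y → ¬ Interval (suc x) (i + (n₂ ∸ i)) y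
  left∩right=∅ {y} (_ , y<) (x<y , _) = <-asym (subst (y <_) left-end y<) x<y
  into : ∀ {y} → Interval 0 (j + (x ∸ j)) y ⊎ Interval (suc x) (i + (n₂ ∸ i)) y → Punctured x n₂ y
  into {y} (inj₁ (_ , y<)) = let y<x = subst (y <_) left-end y< in
    ≤-trans (<⇒≤ y<x) (m≤m+n x n₂) , <⇒≢ y<x
  into {y} (inj₂ (x<y , y<)) = ≤-pred (subst (y <_) right-end y<) , ≢-sym (<⇒≢ x<y)
  sum≡ : j * 0 + triangle j + t₁ + (i * suc x + triangle i + t₂) ≡ v
  sum≡ = begin
    j * 0 + triangle j + t₁ + (i * suc x + triangle i + t₂) ≡⟨ regroup j (triangle j) (i * suc x + triangle i) t₁ t₂ ⟩
    triangle j + (i * suc x + triangle i) + (t₁ + t₂)       ≡⟨ cong (splitMin x j i +_) t₁+t₂≡ ⟩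
    splitMin x j i + (v ∸ splitMin x j i)                   ≡⟨ m+[n∸m]≡n min≤v ⟩
    v                                                       ∎
    where
    open ≡-Reasoning
    regroup : ∀ j a b t₁ t₂ → j * 0 + a + t₁ + (b + t₂) ≡ a + b + (t₁ + t₂)
    regroup = solve-∀

splitMin-full-left : ∀ x i → splitMin x x i ≡ triangle (x + i) + i
splitMin-full-left x i = begin
  triangle x + (i * suc x + triangle i)  ≡⟨ rearrange x i (triangle x) (triangle i) ⟩
  triangle x + triangle i + x * i + i    ≡⟨ cong (_+ i) (sym (triangle-+ x i)) ⟩
  triangle (x + i) + i                   ∎
  where
  open ≡-Reasoning
  rearrange : ∀ x i a b → a + (i * suc x + b) ≡ a + b + x * i + i
  rearrange = solve-∀

splitMax-no-left : ∀ {x n₂ i} → i ≤ n₂ → splitMax x n₂ 0 i + triangle i ≡ i * (x + n₂)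
splitMax-no-left {x} {n₂} {i} i≤n₂ = begin
  i * suc x + triangle i + i * (n₂ ∸ i) + triangle i  ≡⟨ rearrange x i (n₂ ∸ i) (triangle i) ⟩
  triangle i + triangle i + i + i * (x + (n₂ ∸ i))    ≡⟨ cong (_+ i * (x + (n₂ ∸ i))) (triangle-double i) ⟩
  i * i + i * (x + (n₂ ∸ i))                          ≡⟨ rearrange′ x i (n₂ ∸ i) ⟩
  i * (x + (i + (n₂ ∸ i)))                            ≡⟨ cong (λ n → i * (x + n)) (m+[n∸m]≡n i≤n₂) ⟩
  i * (x + n₂)                                        ∎
  where
  open ≡-Reasoning
  rearrange : ∀ x i w t → i * suc x + t + i * w + t ≡ t + t + i + i * (x + w)
  rearrange = solve-∀
  rearrange′ : ∀ x i w → i * i + i * (x + w) ≡ i * (x + (i + w))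
  rearrange′ = solve-∀

splitMax-full-right : ∀ {x n₂ j} → j ≤ x → splitMax x n₂ j n₂ + (triangle (j + n₂) + j) ≡ (j + n₂) * (x + n₂)
splitMax-full-right {x} {n₂} {j} j≤x = begin
  splitMax x n₂ j n₂ + (triangle (j + n₂) + j)
    ≡⟨ cong₂ (λ d t → triangle j + (n₂ * suc x + triangle n₂) + (j * u + n₂ * d) + (t + j))
             (n∸n≡0 n₂) (triangle-+ j n₂) ⟩
  triangle j + (n₂ * suc x + triangle n₂) + (j * u + n₂ * 0) + (triangle j + triangle n₂ + j * n₂ + j)
    ≡⟨ rearrange j n₂ x u (triangle j) (triangle n₂) ⟩
  (triangle j + triangle j + j) + (triangle n₂ + triangle n₂ + n₂) + (n₂ * x + j * u + j * n₂)
    ≡⟨ cong₂ (λ a b → a + b + (n₂ * x + j * u + j * n₂)) (triangle-double j) (triangle-double n₂) ⟩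
  j * j + n₂ * n₂ + (n₂ * x + j * u + j * n₂)
    ≡⟨ cong (λ y → j * j + n₂ * n₂ + (n₂ * y + j * u + j * n₂)) (sym j+u≡x) ⟩
  j * j + n₂ * n₂ + (n₂ * (j + u) + j * u + j * n₂)
    ≡⟨ rearrange′ j n₂ u ⟩
  (j + n₂) * (j + u + n₂)
    ≡⟨ cong (λ y → (j + n₂) * (y + n₂)) j+u≡x ⟩
  (j + n₂) * (x + n₂)  ∎
  where
  open ≡-Reasoning
  u = x ∸ j
  j+u≡x : j + u ≡ x
  j+u≡x = m+[n∸m]≡n j≤x
  rearrange : ∀ j n x u a b → a + (n * suc x + b) + (j * u + n * 0) + (a + b + j * n + j) ≡
                              (a + a + j) + (b + b + n) + (n * x + j * u + j * n)
  rearrange = solve-∀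
  rearrange′ : ∀ j n u → j * j + n * n + (n * (j + u) + j * u + j * n) ≡ (j + n) * (j + u + n)
  rearrange′ = solve-∀

splitMax-shift-one-left : ∀ {x i} → 1 ≤ x → splitMax x (suc i) 1 i + 2 ≡ splitMax x (suc i) 0 (suc i)
splitMax-shift-one-left {suc x′} {i} _ = begin
    splitMin (suc x′) 1 i + (x′ + 0 + i * (suc i ∸ i)) + 2
  ≡⟨ cong (λ d → splitMin (suc x′) 1 i + (x′ + 0 + i * d) + 2) (m+n∸n≡m 1 i) ⟩
    splitMin (suc x′) 1 i + (x′ + 0 + i * 1) + 2
  ≡⟨ rearrange x′ i (triangle i) ⟩
    splitMin (suc x′) 0 (suc i) + (0 + suc i * 0)
  ≡⟨ cong (λ d → splitMin (suc x′) 0 (suc i) + (0 + suc i * d)) (sym (n∸n≡0 i)) ⟩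
    splitMax (suc x′) (suc i) 0 (suc i)
  ∎
  where
  open ≡-Reasoning
  rearrange : ∀ x i t → 0 + (i * suc (suc x) + t) + (x + 0 + i * 1) + 2 ≡
                        0 + (suc i * suc (suc x) + (i + t)) + (0 + suc i * 0)
  rearrange = solve-∀

-- Chains of overlapping intervals

Covers : NSet → ℕ → ℕ → Set
Covers S a b = ∀ v → a ≤ v → v ≤ b → S v

covers-∪ : ∀ {S a b c d} → Covers S a b → Covers S c d → c ≤ suc b → Covers S a d
covers-∪ {b = b} S⊇ab S⊇cd c≤1+b v a≤v v≤d with v ≤? b
... | yes v≤b = S⊇ab v a≤v v≤b
... | no  v≰b = S⊇cd v (≤-trans c≤1+b (≰⇒> v≰b)) v≤d

covers-chain : ∀ {S} (l u : ℕ → ℕ) {a b} → a ≤ b →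
  (∀ t → a ≤ t → t ≤ b → Covers S (l t) (u t)) → (∀ t → a ≤ t → t < b → l (suc t) ≤ suc (u t)) →
  Covers S (l a) (u b)
covers-chain l u {b = zero}  z≤n  S⊇ _ = S⊇ 0 z≤n z≤n
covers-chain l u {b = suc b} a≤1+b S⊇ touch with m≤n⇒m<n∨m≡n a≤1+b
... | inj₂ refl = S⊇ (suc b) a≤1+b ≤-refl
... | inj₁ a<1+b = covers-∪
  (covers-chain l u a≤b (λ t a≤t t≤b → S⊇ t a≤t (m≤n⇒m≤1+n t≤b))
                        (λ t a≤t t<b → touch t a≤t (m≤n⇒m≤1+n t<b)))
  (S⊇ (suc b) a≤1+b ≤-refl) (touch b a≤b ≤-refl)
  where
  a≤b = ≤-pred a<1+b

covers-mono : ∀ {S T : NSet} {a b} → (∀ {v} → S v → T v) → Covers S a b → Covers T a b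
covers-mono S⊆T S⊇ v a≤v v≤b = S⊆T (S⊇ v a≤v v≤b)

covers-shift : ∀ {S T : NSet} {a b} c → (∀ {v} → S v → T (c + v)) → Covers S a b → Covers T (c + a) (c + b)
covers-shift {T = T} {a} c shift S⊇ v c+a≤v v≤c+b =
  subst T (m+[n∸m]≡n c≤v)
    (shift (S⊇ (v ∸ c) (m+n≤o⇒m≤o∸n a (subst (_≤ v) (+-comm c a) c+a≤v)) (m≤n+o⇒m∸n≤o v c v≤c+b)))
  where
  c≤v = ≤-trans (m≤m+n c a) c+a≤v

point-cover : ∀ {S : NSet} {a} → S a → Covers S a a
point-cover {S} Sa v a≤v v≤a = subst S (≤-antisym a≤v v≤a) Sa

singleton-range : ∀ {P : ℕ → Set} {a} → P a → ∀ i → a ≤ i → i < suc a → P i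
singleton-range {P} Pa i a≤i i<1+a = subst P (≤-antisym a≤i (≤-pred i<1+a)) Pa

Touching : ℕ → ℕ → ℕ → ℕ → Set
Touching x n₂ g i = splitMin x (g ∸ suc i) (suc i) ≤ suc (splitMax x n₂ (g ∸ i) i)

splits-cover : ∀ {x n₂ g j₀ i₀ j₁ i₁} → j₀ + i₀ ≡ g → j₁ + i₁ ≡ g → i₀ ≤ i₁ → j₀ ≤ x → i₁ ≤ n₂ →
  (∀ i → i₀ ≤ i → i < i₁ → Touching x n₂ g i) →
  Covers (RestrictedSumset g (Punctured x n₂)) (splitMin x j₀ i₀) (splitMax x n₂ j₁ i₁)
splits-cover {x} {n₂} {g} {j₀} {i₀} {j₁} {i₁} j₀+i₀≡g j₁+i₁≡g i₀≤i₁ j₀≤x i₁≤n₂ touching =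
  subst₂ (Covers (RestrictedSumset g (Punctured x n₂)))
    (cong (λ j → splitMin x j i₀) (complement j₀ i₀ j₀+i₀≡g))
    (cong (λ j → splitMax x n₂ j i₁) (complement j₁ i₁ j₁+i₁≡g))
    (covers-chain (λ i → splitMin x (g ∸ i) i) (λ i → splitMax x n₂ (g ∸ i) i) i₀≤i₁ split touching)
  where
  complement : ∀ j i → j + i ≡ g → g ∸ i ≡ j
  complement j i refl = m+n∸n≡m j i
  split : ∀ i → i₀ ≤ i → i ≤ i₁ →
    Covers (RestrictedSumset g (Punctured x n₂)) (splitMin x (g ∸ i) i) (splitMax x n₂ (g ∸ i) i)
  split i i₀≤i i≤i₁ v min≤v v≤max = subst (λ m → RestrictedSumset m (Punctured x n₂) v) (m∸n+n≡m i≤g)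
    (split-sumset g∸i≤x (≤-trans i≤i₁ i₁≤n₂) min≤v v≤max)
    where
    i≤g : i ≤ g
    i≤g = ≤-trans i≤i₁ (subst (i₁ ≤_) j₁+i₁≡g (m≤n+m i₁ j₁))
    g∸i≤x : g ∸ i ≤ x
    g∸i≤x = ≤-trans (∸-monoʳ-≤ g i₀≤i) (subst (_≤ x) (sym (complement j₀ i₀ j₀+i₀≡g)) j₀≤x)

private
  touch-slack : ∀ J u i w e → suc i + e ≡ J * u + i * w →
    splitMin (suc J + u) J (suc i) + e ≡ suc (J + triangle J + (i * suc (suc J + u) + triangle i) + (suc J * u + i * w))
  touch-slack J u i w e eq = begin
    splitMin (suc J + u) J (suc i) + e    ≡⟨ expand J u i e (triangle J) (triangle i) ⟩
    suc (rest + (u + (suc i + e)))        ≡⟨ cong (λ z → suc (rest + (u + z))) eq ⟩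
    suc (rest + (u + (J * u + i * w)))    ≡⟨ cong (λ z → suc (rest + z)) (sym (+-assoc u (J * u) (i * w))) ⟩
    suc (rest + (suc J * u + i * w))      ∎
    where
    open ≡-Reasoning
    rest = J + triangle J + (i * suc (suc J + u) + triangle i)
    expand : ∀ J u i e a b → a + (suc i * suc (suc J + u) + (i + b)) + e ≡
                             suc (J + a + (i * suc (suc J + u) + b) + (u + (suc i + e)))
    expand = solve-∀

touch : ∀ {x n₂ J i} → suc J ≤ x → suc i ≤ J * (x ∸ suc J) + i * (n₂ ∸ i) →
  splitMin x J (suc i) ≤ suc (splitMax x n₂ (suc J) i)
touch {x} {n₂} {J} {i} 1+J≤x cond =
  subst (λ x → splitMin x J (suc i) ≤ suc (splitMax x n₂ (suc J) i))
    (m+[n∸m]≡n 1+J≤x) (m+o≡n⇒m≤n e (trans (touch-slack J u i (n₂ ∸ i) e eq)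
      (cong (λ d → suc (J + triangle J + (i * suc (suc J + u) + triangle i) + (suc J * d + i * (n₂ ∸ i))))
            (sym (m+n∸m≡n J u)))))
  where
  u = x ∸ suc J
  e = proj₁ (m≤n⇒∃[o]m+o≡n cond)
  eq = proj₂ (m≤n⇒∃[o]m+o≡n cond)

touching : ∀ {x n₂ g i} → suc i ≤ g → g ≤ i + x →
  suc i ≤ (g ∸ suc i) * (x ∸ (g ∸ i)) + i * (n₂ ∸ i) → Touching x n₂ g i
touching {x} {n₂} {g} {i} 1+i≤g g≤i+x cond =
  subst (λ j → splitMin x (g ∸ suc i) (suc i) ≤ suc (splitMax x n₂ j i)) (sym g∸i≡)
    (touch (subst (_≤ x) g∸i≡ (m≤n+o⇒m∸n≤o g i g≤i+x))
           (subst (λ j → suc i ≤ (g ∸ suc i) * (x ∸ j) + i * (n₂ ∸ i)) g∸i≡ cond))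
  where
  g∸i≡ : g ∸ i ≡ suc (g ∸ suc i)
  g∸i≡ = +-∸-assoc 1 1+i≤g

touching-left : ∀ {x n₂ g i} → 2 + i ≤ g → g < i + x → suc i ≤ n₂ → Touching x n₂ g i
touching-left {x} {n₂} {g} {i} 2+i≤g g<i+x 1+i≤n₂ =
  touching 1+i≤g (<⇒≤ g<i+x) (+-mono-≤ (*-mono-≤ (m<n⇒0<n∸m 2+i≤g) (m<n⇒0<n∸m g∸i<x)) i≤i*[n₂∸i])
  where
  1+i≤g = ≤-trans (n≤1+n _) 2+i≤g
  g∸i<x : g ∸ i < x
  g∸i<x = subst (_≤ x) (+-∸-assoc 1 (≤-trans (n≤1+n i) 1+i≤g)) (m≤n+o⇒m∸n≤o (suc g) i g<i+x)
  i≤i*[n₂∸i] : i ≤ i * (n₂ ∸ i)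
  i≤i*[n₂∸i] = subst (_≤ i * (n₂ ∸ i)) (*-identityʳ i) (*-monoʳ-≤ i (m<n⇒0<n∸m 1+i≤n₂))

touching-right : ∀ {x n₂ g i} → 1 ≤ i → suc i ≤ g → 2 + i ≤ n₂ → g ≤ i + x → Touching x n₂ g i
touching-right {x} {n₂} {g} {i} 1≤i 1+i≤g 2+i≤n₂ g≤i+x =
  touching 1+i≤g g≤i+x (≤-trans 1+i≤i*[n₂∸i] (m≤n+m _ _))
  where
  1+i≤i*[n₂∸i] : suc i ≤ i * (n₂ ∸ i)
  1+i≤i*[n₂∸i] = begin
    suc i        ≤⟨ +-monoˡ-≤ i 1≤i ⟩
    i + i        ≡⟨ double i ⟩
    i * 2        ≤⟨ *-monoʳ-≤ i (m+n≤o⇒m≤o∸n 2 2+i≤n₂) ⟩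
    i * (n₂ ∸ i) ∎
    where
    open ≤-Reasoning
    double : ∀ i → i + i ≡ i * 2
    double = solve-∀

touching-all : ∀ {x n₂ g} → 2 ≤ g → g < x → g < n₂ → ∀ i → i < g → Touching x n₂ g i
touching-all {x} {n₂} {g} 2≤g g<x g<n₂ i i<g with 2 + i ≤? g
... | yes 2+i≤g = touching-left 2+i≤g (≤-trans g<x (m≤n+m x i)) (≤-trans i<g (<⇒≤ g<n₂))
... | no  2+i≰g = touching-right (≤-pred (subst (2 ≤_) (sym 1+i≡g) 2≤g)) i<g
                    (subst (_≤ n₂) (cong suc (sym 1+i≡g)) g<n₂) (≤-trans (<⇒≤ g<x) (m≤n+m x i))
  where
  1+i≡g : suc i ≡ g
  1+i≡g = ≤-antisym i<g (≤-pred (≰⇒> 2+i≰g))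

private
  bridge-slack : ∀ j u i w e → 1 + e ≡ j * u + i * w →
    suc (j + u + (suc i + w)) + 1 + splitMin (j + u) j i + e ≡ suc (splitMin (j + u) j (suc i) + (j * u + suc i * w))
  bridge-slack j u i w e eq = begin
    suc (j + u + (suc i + w)) + 1 + splitMin (j + u) j i + e ≡⟨ expand j u i w e (triangle j) (triangle i) ⟩
    suc (splitMin (j + u) j (suc i) + (1 + e + w))           ≡⟨ cong (λ z → suc (min′ + (z + w))) eq ⟩
    suc (splitMin (j + u) j (suc i) + (j * u + i * w + w))   ≡⟨ cong (λ z → suc (min′ + z)) (regroup j u i w) ⟩
    suc (splitMin (j + u) j (suc i) + (j * u + suc i * w))   ∎
    where
    open ≡-Reasoning
    min′ = splitMin (j + u) j (suc i)
    expand : ∀ j u i w e a b → suc (j + u + (suc i + w)) + 1 + (a + (i * suc (j + u) + b)) + e ≡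
                               suc (a + (suc i * suc (j + u) + (i + b)) + (1 + e + w))
    expand = solve-∀
    regroup : ∀ j u i w → j * u + i * w + w ≡ j * u + suc i * w
    regroup = solve-∀

bridge : ∀ {x n₂ j i} → j ≤ x → suc i ≤ n₂ → 1 ≤ j * (x ∸ j) + i * (n₂ ∸ suc i) →
  suc (x + n₂) + 1 + splitMin x j i ≤ suc (splitMax x n₂ j (suc i))
bridge {x} {n₂} {j} {i} j≤x 1+i≤n₂ cond =
  subst₂ (λ x n₂ → suc (x + n₂) + 1 + splitMin x j i ≤ suc (splitMax x n₂ j (suc i)))
    (m+[n∸m]≡n j≤x) (m+[n∸m]≡n 1+i≤n₂) (m+o≡n⇒m≤n e (trans (bridge-slack j u i w e eq)
      (cong₂ (λ d₁ d₂ → suc (splitMin (j + u) j (suc i) + (j * d₁ + suc i * d₂)))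
             (sym (m+n∸m≡n j u)) (sym (m+n∸m≡n i w)))))
  where
  u = x ∸ j
  w = n₂ ∸ suc i
  e = proj₁ (m≤n⇒∃[o]m+o≡n cond)
  eq = proj₂ (m≤n⇒∃[o]m+o≡n cond)

card-interval : ∀ a c → HasCard (Interval a c) c
card-interval a c =
  applyUpTo (a +_) c , Unique.applyUpTo⁺₁ (a +_) c (λ i<j _ → <⇒≢ i<j ∘ +-cancelˡ-≡ a _ _) ,
  (λ v → mk⇔ to from) , length-applyUpTo (a +_) c
  where
  to : ∀ {v} → v ∈ applyUpTo (a +_) c → Interval a c v
  to v∈ with ∈-applyUpTo⁻ (a +_) v∈
  ... | i , i<c , refl = m≤m+n a i , +-monoʳ-< a i<c
  from : ∀ {v} → Interval a c v → v ∈ applyUpTo (a +_) c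
  from {v} (a≤v , v<a+c) = subst (_∈ applyUpTo (a +_) c) (m+[n∸m]≡n a≤v) (∈-applyUpTo⁺ (a +_)
    (subst (_≤ c) (+-∸-assoc 1 a≤v) (m≤n+o⇒m∸n≤o (suc v) a v<a+c)))

card-⇔ : ∀ {S T : NSet} {c} → (∀ v → S v ⇔ T v) → HasCard S c → HasCard T c
card-⇔ S⇔T (l , u , l⇔S , len) =
  l , u , (λ v → mk⇔ (Equivalence.to (S⇔T v) ∘ Equivalence.to (l⇔S v))
                     (Equivalence.from (l⇔S v) ∘ Equivalence.from (S⇔T v))) , len

card-⊎ : ∀ {S T : NSet} {m n} → (∀ {v} → S v → ¬ T v) → HasCard S m → HasCard T n →
  HasCard (λ v → S v ⊎ T v) (m + n)
card-⊎ {S} {T} S∩T=∅ (l₁ , u₁ , l₁⇔S , len₁) (l₂ , u₂ , l₂⇔T , len₂) =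
  l₁ ++ l₂ ,
  Unique.++⁺ u₁ u₂ (λ (v∈l₁ , v∈l₂) → S∩T=∅ (to l₁⇔S v∈l₁) (to l₂⇔T v∈l₂)) ,
  (λ v → mk⇔ (λ v∈ → Sum.map (to l₁⇔S) (to l₂⇔T) (∈-++⁻ l₁ v∈))
             [ ∈-++⁺ˡ ∘ from l₁⇔S , ∈-++⁺ʳ l₁ ∘ from l₂⇔T ]′) ,
  trans (length-++ l₁) (cong₂ _+_ len₁ len₂)
  where
  to : ∀ {P : NSet} {l v} → (∀ n → n ∈ l ⇔ P n) → v ∈ l → P v
  to l⇔P = Equivalence.to (l⇔P _)
  from : ∀ {P : NSet} {l v} → (∀ n → n ∈ l ⇔ P n) → P v → v ∈ l
  from l⇔P = Equivalence.from (l⇔P _)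

card-from-bounds : ∀ {S a b c} → (∀ v → S v → a ≤ v × v ≤ b) → Covers S a b → a + c ≡ suc b → HasCard S c
card-from-bounds {S} {a} {b} {c} bounds S⊇ a+c≡ = card-⇔ (λ v → mk⇔
  (λ (a≤v , v<a+c) → S⊇ v a≤v (≤-pred (subst (suc v ≤_) a+c≡ v<a+c)))
  (λ Sv → proj₁ (bounds v Sv) , subst (suc v ≤_) (sym a+c≡) (s≤s (proj₂ (bounds v Sv)))))
  (card-interval a c)

card-from-bounds-punctured : ∀ {S a q b c₁ c₂} → (∀ v → S v → a ≤ v × v ≤ b) → ¬ S (suc q) →
  Covers S a q → Covers S (suc (suc q)) b → a + c₁ ≡ suc q → suc (suc q) + c₂ ≡ suc b → HasCard S (c₁ + c₂)
card-from-bounds-punctured {S} {a} {q} {b} {c₁} {c₂} bounds ¬Sp S⊇below S⊇above below-end above-end =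
  card-⇔ (λ v → mk⇔ [ below , above ]′ split)
    (card-⊎ disjoint (card-interval a c₁) (card-interval (suc (suc q)) c₂))
  where
  disjoint : ∀ {v} → Interval a c₁ v → ¬ Interval (suc (suc q)) c₂ v
  disjoint {v} (_ , v<) (q<v , _) = <-asym (subst (v <_) below-end v<) q<v
  below : ∀ {v} → Interval a c₁ v → S v
  below {v} (a≤v , v<) = S⊇below v a≤v (≤-pred (subst (v <_) below-end v<))
  above : ∀ {v} → Interval (suc (suc q)) c₂ v → S v
  above {v} (q<v , v<) = S⊇above v q<v (≤-pred (subst (v <_) above-end v<))
  split : ∀ {v} → S v → Interval a c₁ v ⊎ Interval (suc (suc q)) c₂ v
  split {v} Sv with v ≤? q
  ... | yes v≤q = inj₁ (proj₁ (bounds v Sv) , subst (v <_) (sym below-end) (s≤s v≤q))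
  ... | no  v≰q = inj₂ (≤∧≢⇒< (≰⇒> v≰q) (λ p≡v → ¬Sp (subst S (sym p≡v) Sv)) ,
                        subst (v <_) (sym above-end) (s≤s (proj₂ (bounds v Sv))))

-- The restricted sumset of A

module RestrictedSumsetOfA (g x n₂ : ℕ) where

  h = suc g
  k = suc (x + n₂)

  S : NSet
  S = RestrictedSumset h (Aset k x)

  B : NSet
  B = Punctured x n₂

  B⊆A : ∀ {y} → B y → Aset k x y
  B⊆A (y≤ , y≢x) =
    ≤-trans y≤ (≤-trans (n≤1+n _) (m≤m+n k 1)) , y≢x , λ y≡k → 1+n≰n (subst (_≤ x + n₂) y≡k y≤)

  A⊆B∪top : ∀ {y} → Aset k x y → y ≢ k + 1 → B y
  A⊆B∪top {y} (y≤ , y≢x , y≢k) y≢top =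
    ≤-pred (≤∧≢⇒< (≤-pred (subst (y <_) (+-comm k 1) (≤∧≢⇒< y≤ y≢top))) y≢k) , y≢x

  S-from-B : ∀ {v} → RestrictedSumset h B v → S v
  S-from-B = sumset-mono B⊆A

  S-from-B-and-top : ∀ {v} → RestrictedSumset g B v → S (k + 1 + v)
  S-from-B-and-top = sumset-mono [ (λ { refl → top∈A }) , B⊆A ]′ ∘ sumset-∷ top∉B
    where
    top∉B : ¬ B (k + 1)
    top∉B (top≤ , _) = 1+n≰n (≤-trans (m≤m+n k 1) top≤)
    top∈A : Aset k x (k + 1)
    top∈A = ≤-refl , >⇒≢ (≤-trans (s≤s (m≤m+n x n₂)) (m≤m+n k 1)) , >⇒≢ (m<m+n k z<s)

  S-split : ∀ {v} → S v → RestrictedSumset h B v ⊎ ∃[ s ] (RestrictedSumset g B s × v ≡ k + 1 + s)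
  S-split (l , len , u , l∈A , sum≡) with (k + 1) ∈? l
  ... | no top∉l = inj₁ (l , len , u ,
    All.tabulate (λ y∈l → A⊆B∪top (All.lookup l∈A y∈l) λ y≡top → top∉l (subst (_∈ l) y≡top y∈l)) ,
    sum≡)
  ... | yes top∈l with ∈⇒↭∷ top∈l
  ...   | r , l↭ with All-resp-↭ l↭ l∈A | unique-↭ l↭ u
  ...     | _ ∷ r∈A | top∉r ∷ ur =
    inj₂ (sum r , (r , suc-injective (trans (sym (↭-length l↭)) len) , ur ,
      All.zipWith (λ (Ay , top≢y) → A⊆B∪top Ay (≢-sym top≢y)) (r∈A , top∉r) , refl) ,
      trans (sym sum≡) (sum-↭ l↭))

  S-lower : ∀ {v} → S v → triangle h + (h ∸ x) ≤ v
  S-lower (l , len , u , l∈A , sum≡) =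
    subst₂ (λ n s → triangle n + (n ∸ x) ≤ s) len sum≡ (sum-lower-bound x u (All.map (proj₁ ∘ proj₂) l∈A))

  B-upper : ∀ {m s} → RestrictedSumset m B s → s + (triangle m + (m ∸ n₂)) ≤ m * (x + n₂)
  B-upper (l , len , u , l∈B , sum≡) =
    subst₂ (λ n s → s + (triangle n + (n ∸ n₂)) ≤ n * (x + n₂)) len sum≡
      (subst (λ d → sum l + (triangle (length l) + (length l ∸ d)) ≤ length l * (x + n₂)) (m+n∸m≡n x n₂)
        (sum-upper-bound (x + n₂) x (m≤m+n x n₂) (All.map proj₁ l∈B) u (All.map proj₂ l∈B)))

  S-upper : ∀ {v} → S v → v + (triangle g + (g ∸ n₂)) ≤ k + 1 + g * (x + n₂)
  S-upper {v} Sv with S-split Sv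
  ... | inj₁ B-sum = begin
    v + (triangle g + (g ∸ n₂))  ≤⟨ +-monoʳ-≤ v (+-monoʳ-≤ (triangle g) (m∸n≤m g n₂)) ⟩
    v + (triangle g + g)         ≤⟨ +-monoʳ-≤ v (≤-reflexive (+-comm (triangle g) g)) ⟩
    v + triangle h               ≤⟨ +-monoʳ-≤ v (m≤m+n (triangle h) (h ∸ n₂)) ⟩
    v + (triangle h + (h ∸ n₂))  ≤⟨ B-upper B-sum ⟩
    h * (x + n₂)                 ≤⟨ +-monoˡ-≤ (g * (x + n₂)) (≤-trans (n≤1+n (x + n₂)) (m≤m+n k 1)) ⟩
    k + 1 + g * (x + n₂)         ∎
    where open ≤-Reasoning
  ... | inj₂ (s , B-sum , refl) = begin
    k + 1 + s + (triangle g + (g ∸ n₂)) ≡⟨ +-assoc (k + 1) s _ ⟩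
    k + 1 + (s + (triangle g + (g ∸ n₂))) ≤⟨ +-monoʳ-≤ (k + 1) (B-upper B-sum) ⟩
    k + 1 + g * (x + n₂)                ∎
    where open ≤-Reasoning

  S-bottom-gap : x ≡ h → ¬ S (suc (triangle h))
  S-bottom-gap x≡h (l , len , u , l∈A , sum≡) = sum≢suc-triangle u
    (All.map (λ {y} (_ , y≢x , _) → subst (y ≢_) (trans x≡h (sym len)) y≢x) l∈A)
    (trans sum≡ (cong (suc ∘ triangle) (sym len)))

  -- The reflection y ↦ x + n₂ ∸ y turns this into sum≢suc-triangle.
  B-top-gap : ∀ {m s} → n₂ ≡ m → suc (s + triangle m) ≡ m * (x + n₂) → ¬ RestrictedSumset m B s
  B-top-gap {m} {s} n₂≡m s≡ (r , len , u , r∈B , sum≡) =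
    sum≢suc-triangle (reflect-unique c r≤c u) reflection-avoids-length reflected-sum
    where
    c = x + n₂
    r≤c = All.map proj₁ r∈B
    r′ = map (c ∸_) r
    len′ : length r′ ≡ m
    len′ = trans (length-map (c ∸_) r) len
    reflection-avoids-length : All (_≢ length r′) r′
    reflection-avoids-length = subst (λ n → All (_≢ n) r′) (trans (m+n∸m≡n x n₂) (trans n₂≡m (sym len′)))
      (reflect-avoids c (m≤m+n x n₂) r≤c (All.map proj₂ r∈B))
    reflected-sum : sum r′ ≡ suc (triangle (length r′))
    reflected-sum = +-cancelʳ-≡ (sum r) _ _ (begin
      sum r′ + sum r                    ≡⟨ reflect-sum c r≤c ⟩
      length r * c                      ≡⟨ cong (_* c) len ⟩
      m * c                             ≡⟨ sym s≡ ⟩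
      suc (s + triangle m)              ≡⟨ cong suc (+-comm s (triangle m)) ⟩
      suc (triangle m) + s              ≡⟨ cong₂ (λ n t → suc (triangle n) + t) (sym len′) (sym sum≡) ⟩
      suc (triangle (length r′)) + sum r ∎)
      where open ≡-Reasoning

  S-top-gap : ∀ {v} → n₂ ≡ g → v + triangle g ≡ k + g * (x + n₂) → ¬ S v
  S-top-gap {v} n₂≡g v≡ Sv with S-split Sv
  ... | inj₁ B-sum = 1+n≰n (subst (_≤ h * (x + n₂)) v≡
    (≤-trans (+-monoʳ-≤ v (≤-trans (m≤n+m (triangle g) g) (m≤m+n (triangle h) (h ∸ n₂)))) (B-upper B-sum)))
  ... | inj₂ (s , B-sum , refl) = B-top-gap n₂≡g (+-cancelˡ-≡ k _ _ (trans (regroup k s (triangle g)) v≡)) B-sum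
    where
    regroup : ∀ k s t → k + suc (s + t) ≡ k + 1 + s + t
    regroup = solve-∀

  covers-S : ∀ {a b j i} → Covers (RestrictedSumset h B) a (splitMax x n₂ j (suc i)) →
    Covers (RestrictedSumset g B) (splitMin x j i) b → j ≤ x → suc i ≤ n₂ → 1 ≤ j * (x ∸ j) + i * (n₂ ∸ suc i) →
    Covers S a (k + 1 + b)
  covers-S B⊇ B⊇′ j≤x 1+i≤n₂ cond =
    covers-∪ (covers-mono S-from-B B⊇) (covers-shift (k + 1) S-from-B-and-top B⊇′) (bridge j≤x 1+i≤n₂ cond)

  private
    S-bounds : ∀ {a b δ₁ δ₂} → h ∸ x ≡ δ₁ → g ∸ n₂ ≡ δ₂ → a ≡ triangle h + δ₁ →
      b + (triangle g + δ₂) ≡ k + 1 + g * (x + n₂) → ∀ v → S v → a ≤ v × v ≤ b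
    S-bounds refl refl a≡ b≡ v Sv =
      subst (_≤ v) (sym a≡) (S-lower Sv) ,
      +-cancelʳ-≤ _ v _ (subst (v + (triangle g + (g ∸ n₂)) ≤_) (sym b≡) (S-upper Sv))

    extremes-distance : ∀ {a b c δ₁ δ₂} → a ≡ triangle h + δ₁ → b + (triangle g + δ₂) ≡ k + 1 + g * (x + n₂) →
      c + g * g + δ₁ + δ₂ ≡ h * (x + n₂) + 3 → a + c ≡ suc b
    extremes-distance {a} {b} {c} {δ₁} {δ₂} refl b≡ c≡ = +-cancelʳ-≡ (triangle g + δ₂) _ _ (begin
      g + triangle g + δ₁ + c + (triangle g + δ₂) ≡⟨ rearrange g (triangle g) δ₁ δ₂ c ⟩
      triangle g + triangle g + g + c + δ₁ + δ₂   ≡⟨ cong (λ z → z + c + δ₁ + δ₂) (triangle-double g) ⟩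
      g * g + c + δ₁ + δ₂                         ≡⟨ cong (λ z → z + δ₁ + δ₂) (+-comm (g * g) c) ⟩
      c + g * g + δ₁ + δ₂                         ≡⟨ c≡ ⟩
      h * (x + n₂) + 3                            ≡⟨ rearrange′ g (x + n₂) ⟩
      suc (k + 1 + g * (x + n₂))                  ≡⟨ cong suc (sym b≡) ⟩
      suc b + (triangle g + δ₂)                   ∎)
      where
      open ≡-Reasoning
      rearrange : ∀ g t δ₁ δ₂ c → g + t + δ₁ + c + (t + δ₂) ≡ t + t + g + c + δ₁ + δ₂
      rearrange = solve-∀
      rearrange′ : ∀ g y → suc g * y + 3 ≡ suc (suc y + 1 + g * y)
      rearrange′ = solve-∀

  -- c is the length of [a, b]; the triangular numbers cancel since triangle h + triangle g = g * g.
  card-S : ∀ {a b c δ₁ δ₂} → h ∸ x ≡ δ₁ → g ∸ n₂ ≡ δ₂ → a ≡ triangle h + δ₁ →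
    b + (triangle g + δ₂) ≡ k + 1 + g * (x + n₂) → c + g * g + δ₁ + δ₂ ≡ h * (x + n₂) + 3 →
    Covers S a b → HasCard S c
  card-S δ₁≡ δ₂≡ a≡ b≡ c≡ S⊇ =
    card-from-bounds (S-bounds δ₁≡ δ₂≡ a≡ b≡) S⊇ (extremes-distance a≡ b≡ c≡)

  card-S-punctured : ∀ {a q b c₁ c₂ δ₁ δ₂} → h ∸ x ≡ δ₁ → g ∸ n₂ ≡ δ₂ → a ≡ triangle h + δ₁ →
    b + (triangle g + δ₂) ≡ k + 1 + g * (x + n₂) → suc (c₁ + c₂) + g * g + δ₁ + δ₂ ≡ h * (x + n₂) + 3 →
    ¬ S (suc q) → Covers S a q → Covers S (suc (suc q)) b → a + c₁ ≡ suc q ⊎ suc (suc q) + c₂ ≡ suc b →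
    HasCard S (c₁ + c₂)
  card-S-punctured {a} {q} {b} {c₁} {c₂} δ₁≡ δ₂≡ a≡ b≡ c≡ ¬Sp S⊇below S⊇above one-side =
    card-from-bounds-punctured (S-bounds δ₁≡ δ₂≡ a≡ b≡) ¬Sp S⊇below S⊇above (proj₁ sides) (proj₂ sides)
    where
    total : suc (a + c₁ + c₂) ≡ suc b
    total = trans (cong suc (+-assoc a c₁ c₂)) (trans (sym (+-suc a (c₁ + c₂))) (extremes-distance a≡ b≡ c≡))
    sides : a + c₁ ≡ suc q × suc (suc q) + c₂ ≡ suc b
    sides = [ (λ below-end → below-end , trans (cong (λ z → suc z + c₂) (sym below-end)) total)
            , (λ above-end → +-cancelʳ-≡ c₂ _ _ (suc-injective (trans total (sym above-end))) , above-end)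
            ]′ one-side

  covers-all-splits : 2 ≤ g → g < x → g < n₂ → Covers (RestrictedSumset g B) (splitMin x g 0) (splitMax x n₂ 0 g)
  covers-all-splits 2≤g g<x g<n₂ =
    splits-cover (+-identityʳ g) refl z≤n (<⇒≤ g<x) (<⇒≤ g<n₂) (λ i _ → touching-all 2≤g g<x g<n₂ i)

  covers-S-from-min : ∀ {b} → 1 ≤ g → 2 + g ≤ x → 1 ≤ n₂ →
    Covers (RestrictedSumset g B) (splitMin x g 0) b → Covers S (triangle h + 0) (k + 1 + b)
  covers-S-from-min 1≤g 2+g≤x 1≤n₂ B⊇ =
    covers-S first-step B⊇ (≤-trans (n≤1+n g) h≤x) 1≤n₂
      (≤-trans (*-mono-≤ 1≤g (m<n⇒0<n∸m h≤x)) (m≤m+n _ 0))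
    where
    h≤x = ≤-trans (n≤1+n h) 2+g≤x
    first-step : Covers (RestrictedSumset h B) (splitMin x h 0) (splitMax x n₂ g 1)
    first-step = splits-cover (+-identityʳ h) (+-comm g 1) z≤n h≤x 1≤n₂
      (singleton-range (touching-left (s≤s 1≤g) 2+g≤x 1≤n₂))

  top-no-left : g ≤ n₂ → k + 1 + splitMax x n₂ 0 g + (triangle g + 0) ≡ k + 1 + g * (x + n₂)
  top-no-left g≤n₂ = trans (+-assoc (k + 1) _ _)
    (cong (k + 1 +_) (trans (cong (splitMax x n₂ 0 g +_) (+-identityʳ _)) (splitMax-no-left g≤n₂)))

  top-full-right : ∀ {e} → e + n₂ ≡ g → e ≤ x →
    k + 1 + splitMax x n₂ e n₂ + (triangle g + e) ≡ k + 1 + g * (x + n₂)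
  top-full-right {e} e+n₂≡g e≤x = trans (+-assoc (k + 1) _ _) (cong (k + 1 +_)
    (subst (λ m → splitMax x n₂ e n₂ + (triangle m + e) ≡ m * (x + n₂)) e+n₂≡g (splitMax-full-right e≤x)))

count-middle-x : ∀ {g y} → g ≤ y → suc g * suc y ∸ suc g * suc g + suc g + 2 + g * g + 0 + 0 ≡ suc g * y + 3
count-middle-x {g} {y} g≤y = begin
  suc g * suc y ∸ suc g * suc g + suc g + 2 + g * g + 0 + 0   ≡⟨ regroup (suc g * suc y ∸ suc g * suc g) g ⟩
  suc g * suc y ∸ suc g * suc g + (suc g + 2 + g * g)         ≡⟨ m+e≡r+n⇒m∸n+e≡r square≤ (expand g y) ⟩
  suc g * y + 3                                               ∎
  where
  open ≡-Reasoning
  square≤ = *-monoʳ-≤ (suc g) (s≤s g≤y)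
  regroup : ∀ d g → d + suc g + 2 + g * g + 0 + 0 ≡ d + (suc g + 2 + g * g)
  regroup = solve-∀
  expand : ∀ g y → suc g * suc y + (suc g + 2 + g * g) ≡ suc g * y + 3 + suc g * suc g
  expand = solve-∀

count-small-x : ∀ {g x n₂} → x ≤ g → g ≤ n₂ →
  suc g * suc (x + n₂) ∸ suc g * suc g + x + 2 + g * g + suc (g ∸ x) + 0 ≡ suc g * (x + n₂) + 3
count-small-x {g} {x} {n₂} x≤g g≤n₂ = begin
  suc g * k ∸ suc g * suc g + x + 2 + g * g + suc r + 0  ≡⟨ regroup (suc g * k ∸ suc g * suc g) x g r ⟩
  suc g * k ∸ suc g * suc g + (x + 2 + g * g + suc r)    ≡⟨ m+e≡r+n⇒m∸n+e≡r square≤ expand ⟩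
  suc g * (x + n₂) + 3                                   ∎
  where
  open ≡-Reasoning
  k = suc (x + n₂)
  r = g ∸ x
  square≤ = *-monoʳ-≤ (suc g) (s≤s (≤-trans g≤n₂ (m≤n+m n₂ x)))
  regroup : ∀ d x g r → d + x + 2 + g * g + suc r + 0 ≡ d + (x + 2 + g * g + suc r)
  regroup = solve-∀
  expand′ : ∀ x r n → suc (x + r) * suc (x + n) + (x + 2 + (x + r) * (x + r) + suc r) ≡
                      suc (x + r) * (x + n) + 3 + suc (x + r) * suc (x + r)
  expand′ = solve-∀
  expand : suc g * k + (x + 2 + g * g + suc r) ≡ suc g * (x + n₂) + 3 + suc g * suc g
  expand = subst (λ g → suc g * k + (x + 2 + g * g + suc r) ≡ suc g * (x + n₂) + 3 + suc g * suc g)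
                 (m+[n∸m]≡n x≤g) (expand′ x r n₂)

count-large-x : ∀ {g x n₂} → n₂ ≤ g → g ≤ x →
  (suc g + 1) * suc (x + n₂) ∸ suc g * suc g ∸ x + 2 + g * g + 0 + (g ∸ n₂) ≡ suc g * (x + n₂) + 3
count-large-x {g} {x} {n₂} n₂≤g g≤x = begin
  (suc g + 1) * k ∸ suc g * suc g ∸ x + 2 + g * g + 0 + e  ≡⟨ regroup ((suc g + 1) * k ∸ suc g * suc g ∸ x) g e ⟩
  (suc g + 1) * k ∸ suc g * suc g ∸ x + (2 + g * g + e)    ≡⟨ m+e≡r+n⇒m∸n+e≡r x≤ (m+e≡r+n⇒m∸n+e≡r square≤ expand) ⟩
  suc g * (x + n₂) + 3                                     ∎
  where
  open ≡-Reasoning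
  k = suc (x + n₂)
  e = g ∸ n₂
  split : ∀ g k → k + suc g * k ≡ (suc g + 1) * k
  split = solve-∀
  square≤k-multiple : suc g * suc g ≤ suc g * k
  square≤k-multiple = *-monoʳ-≤ (suc g) (s≤s (≤-trans g≤x (m≤m+n x n₂)))
  square≤ : suc g * suc g ≤ (suc g + 1) * k
  square≤ = ≤-trans square≤k-multiple (≤-trans (m≤n+m _ k) (≤-reflexive (split g k)))
  x≤ : x ≤ (suc g + 1) * k ∸ suc g * suc g
  x≤ = m+n≤o⇒m≤o∸n x (≤-trans (+-mono-≤ (≤-trans (m≤m+n x n₂) (n≤1+n _)) square≤k-multiple)
                                (≤-reflexive (split g k)))
  regroup : ∀ d g e → d + 2 + g * g + 0 + e ≡ d + (2 + g * g + e)
  regroup = solve-∀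
  expand′ : ∀ e n x → (suc (e + n) + 1) * suc (x + n) + (2 + (e + n) * (e + n) + e) ≡
                      suc (e + n) * (x + n) + 3 + x + suc (e + n) * suc (e + n)
  expand′ = solve-∀
  expand : (suc g + 1) * k + (2 + g * g + e) ≡ suc g * (x + n₂) + 3 + x + suc g * suc g
  expand = subst (λ g → (suc g + 1) * k + (2 + g * g + e) ≡ suc g * (x + n₂) + 3 + x + suc g * suc g)
                 (m∸n+n≡m n₂≤g) (expand′ e n₂ x)

card-small-x : ∀ {g x n₂} → 1 ≤ x → x ≤ g → 2 + g ≤ n₂ →
  HasCard (RestrictedSumset (suc g) (Aset (suc (x + n₂)) x)) (suc g * suc (x + n₂) ∸ suc g * suc g + x + 2)
card-small-x {g} {x@(suc x′)} {n₂} _ x≤g 2+g≤n₂ =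
  card-S (+-∸-assoc 1 x≤g) (m≤n⇒m∸n≡0 g≤n₂) bottom (top-no-left g≤n₂) (count-small-x x≤g g≤n₂)
    (covers-S first-steps row (n≤1+n x′) 2+r≤n₂
      (≤-trans (*-mono-≤ (s≤s {n = r} z≤n) (m<n⇒0<n∸m 3+r≤n₂)) (m≤n+m _ (x′ * (x ∸ x′)))))
  where
  open RestrictedSumsetOfA g x n₂
  r = g ∸ x
  x+r≡g : x + r ≡ g
  x+r≡g = m+[n∸m]≡n x≤g
  r<g : r < g
  r<g = subst (suc r ≤_) x+r≡g (s≤s (m≤n+m r x′))
  3+r≤n₂ : 3 + r ≤ n₂
  3+r≤n₂ = ≤-trans (s≤s (s≤s r<g)) 2+g≤n₂
  2+r≤n₂ = ≤-trans (n≤1+n _) 3+r≤n₂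
  g≤n₂ = ≤-trans (n≤1+n g) (≤-trans (n≤1+n _) 2+g≤n₂)
  g≡r+x : g ≡ r + x
  g≡r+x = trans (sym x+r≡g) (+-comm x r)
  x+1+r≡h : x + suc r ≡ h
  x+1+r≡h = trans (+-suc x r) (cong suc x+r≡g)
  bottom : splitMin x x (suc r) ≡ triangle h + suc r
  bottom = trans (splitMin-full-left x (suc r)) (cong (λ m → triangle m + suc r) x+1+r≡h)
  first-steps : Covers (RestrictedSumset h B) (splitMin x x (suc r)) (splitMax x n₂ x′ (suc (suc r)))
  first-steps = splits-cover x+1+r≡h (trans (+-suc x′ (suc r)) (cong suc (trans (+-suc x′ r) x+r≡g)))
    (n≤1+n _) ≤-refl 2+r≤n₂
    (singleton-range (touching-right (s≤s z≤n) (s≤s r<g) 3+r≤n₂ (≤-reflexive (cong suc g≡r+x))))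
  row : Covers (RestrictedSumset g B) (splitMin x x′ (suc r)) (splitMax x n₂ 0 g)
  row = splits-cover (trans (+-suc x′ r) x+r≡g) refl r<g (n≤1+n x′) g≤n₂
    (λ i r<i i<g → touching-right (≤-trans (s≤s z≤n) r<i) i<g
                     (≤-trans (s≤s i<g) (≤-trans (n≤1+n _) 2+g≤n₂))
                     (≤-trans (≤-reflexive g≡r+x) (+-monoˡ-≤ x (<⇒≤ r<i))))

card-x≡h : ∀ {g x n₂} → x ≡ suc g → 2 ≤ g → suc g < n₂ →
  HasCard (RestrictedSumset (suc g) (Aset (suc (x + n₂)) x)) (suc g * suc (x + n₂) ∸ suc g * suc g + suc g + 1)
card-x≡h {g} {x} {n₂} refl 2≤g h<n₂ =
  subst (HasCard S) (+-comm 1 _)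
    (card-S-punctured (n∸n≡0 h) (m≤n⇒m∸n≡0 g≤n₂) (sym (+-identityʳ _)) (top-no-left g≤n₂) count
      (S-bottom-gap refl) (point-cover S-min) above-gap (inj₁ (+-comm (triangle h) 1)))
  where
  open RestrictedSumsetOfA g x n₂
  g≤n₂ = ≤-trans (n≤1+n g) (<⇒≤ h<n₂)
  count : suc (1 + (h * k ∸ h * h + h)) + g * g + 0 + 0 ≡ h * (x + n₂) + 3
  count = trans (cong (λ z → z + g * g + 0 + 0) (+-comm 2 (h * k ∸ h * h + h)))
                (count-middle-x (≤-trans (n≤1+n g) (m≤m+n x n₂)))
  S-min : S (triangle h)
  S-min = S-from-B (subst (λ m → RestrictedSumset m B (triangle h)) (+-identityʳ h)
    (split-sumset ≤-refl z≤n (≤-reflexive (+-identityʳ _))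
                  (≤-trans (≤-reflexive (sym (+-identityʳ _))) (m≤m+n _ _))))
  first-after-gap : splitMin x g 1 ≡ suc (suc (triangle h))
  first-after-gap = rearrange g (triangle g)
    where
    rearrange : ∀ g t → t + (1 * suc (suc g) + 0) ≡ suc (suc (g + t))
    rearrange = solve-∀
  above-gap : Covers S (suc (suc (triangle h))) (k + 1 + splitMax x n₂ 0 g)
  above-gap = subst (λ a → Covers S a (k + 1 + splitMax x n₂ 0 g)) first-after-gap
    (covers-S (splits-cover (+-comm g 1) (+-comm g 1) ≤-refl (n≤1+n g) (≤-trans (s≤s z≤n) h<n₂)
                 (λ i 1≤i i<1 → ⊥-elim (1+n≰n (≤-trans i<1 1≤i))))
              (covers-all-splits 2≤g ≤-refl (≤-trans (n≤1+n _) h<n₂)) (n≤1+n g) (≤-trans (s≤s z≤n) h<n₂)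
              (≤-trans (*-mono-≤ (≤-trans (s≤s z≤n) 2≤g) (m<n⇒0<n∸m (n<1+n g))) (m≤m+n _ 0)))

card-x≡k∸h : ∀ {g x n₂} → n₂ ≡ g → 2 ≤ g → 2 + g ≤ x →
  HasCard (RestrictedSumset (suc g) (Aset (suc (x + n₂)) x)) (suc g * suc (x + n₂) ∸ suc g * suc g + suc g + 1)
card-x≡k∸h {g@(suc g′)} {x} {n₂} refl 2≤g@(s≤s _) 2+g≤x =
  card-S-punctured (m≤n⇒m∸n≡0 (<⇒≤ 2+g≤x)) (n∸n≡0 g) refl (top-no-left ≤-refl) count
    (S-top-gap refl gap≡) below-gap (subst (λ a → Covers S a top) (sym top≡) (point-cover S-max))
    (inj₂ (trans (+-comm _ 1) (cong suc top≡)))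
  where
  open RestrictedSumsetOfA g x n₂
  top = k + 1 + splitMax x n₂ 0 g
  second = k + 1 + splitMax x n₂ 1 g′
  top≡ : suc (suc second) ≡ top
  top≡ = trans (regroup (k + 1) (splitMax x n₂ 1 g′))
               (cong (k + 1 +_) (splitMax-shift-one-left {i = g′} (≤-trans (s≤s z≤n) 2+g≤x)))
    where
    regroup : ∀ a b → suc (suc (a + b)) ≡ a + (b + 2)
    regroup = solve-∀
  gap≡ : suc second + triangle g ≡ k + g * (x + n₂)
  gap≡ = suc-injective (begin
    suc (suc second + triangle g)  ≡⟨ cong (_+ triangle g) top≡ ⟩
    top + triangle g               ≡⟨ cong (top +_) (sym (+-identityʳ _)) ⟩
    top + (triangle g + 0)         ≡⟨ top-no-left ≤-refl ⟩
    k + 1 + g * (x + n₂)           ≡⟨ cong (_+ g * (x + n₂)) (+-comm k 1) ⟩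
    suc (k + g * (x + n₂))         ∎)
    where open ≡-Reasoning
  count : suc (h * k ∸ h * h + h + 1) + g * g + 0 + 0 ≡ h * (x + n₂) + 3
  count = trans (cong (λ z → z + g * g + 0 + 0) (sym (+-suc (h * k ∸ h * h + h) 1)))
                (count-middle-x (≤-trans (≤-trans (n≤1+n g) (<⇒≤ 2+g≤x)) (m≤m+n x n₂)))
  S-max : S top
  S-max = S-from-B-and-top (split-sumset z≤n ≤-refl (m≤m+n _ _) ≤-refl)
  below-gap : Covers S (triangle h + 0) second
  below-gap = covers-S-from-min (s≤s z≤n) 2+g≤x (s≤s z≤n)
    (splits-cover (+-identityʳ g) refl z≤n (≤-trans (n≤1+n g) (<⇒≤ 2+g≤x)) (n≤1+n g′)
      (λ i _ i<g′ → touching-left (s≤s i<g′) (≤-trans (<⇒≤ 2+g≤x) (m≤n+m x i))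
                                   (≤-trans i<g′ (n≤1+n g′))))

card-middle-x : ∀ {g x n₂} → 2 ≤ g → 2 + g ≤ x → suc g ≤ n₂ →
  HasCard (RestrictedSumset (suc g) (Aset (suc (x + n₂)) x)) (suc g * suc (x + n₂) ∸ suc g * suc g + suc g + 2)
card-middle-x {g} {x} {n₂} 2≤g 2+g≤x g<n₂ =
  card-S (m≤n⇒m∸n≡0 (<⇒≤ 2+g≤x)) (m≤n⇒m∸n≡0 (<⇒≤ g<n₂)) refl (top-no-left (<⇒≤ g<n₂))
    (count-middle-x (≤-trans (<⇒≤ g<x) (m≤m+n x n₂)))
    (covers-S-from-min (≤-trans (s≤s z≤n) 2≤g) 2+g≤x (≤-trans (s≤s z≤n) g<n₂)
                       (covers-all-splits 2≤g g<x g<n₂))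
  where
  open RestrictedSumsetOfA g x n₂
  g<x = ≤-trans (n≤1+n _) 2+g≤x

card-large-x : ∀ {g x n₂} → 1 ≤ n₂ → n₂ < g → 2 + g ≤ x →
  HasCard (RestrictedSumset (suc g) (Aset (suc (x + n₂)) x)) ((suc g + 1) * suc (x + n₂) ∸ suc g * suc g ∸ x + 2)
card-large-x {g} {x} {n₂} 1≤n₂ n₂<g 2+g≤x =
  card-S (m≤n⇒m∸n≡0 (<⇒≤ 2+g≤x)) refl refl (top-full-right e+n₂≡g (≤-trans (m∸n≤m g n₂) g≤x))
    (count-large-x (<⇒≤ n₂<g) g≤x) (covers-S-from-min (≤-trans 1≤n₂ (<⇒≤ n₂<g)) 2+g≤x 1≤n₂ row)
  where
  open RestrictedSumsetOfA g x n₂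
  e = g ∸ n₂
  e+n₂≡g = m∸n+n≡m (<⇒≤ n₂<g)
  g≤x = ≤-trans (n≤1+n g) (<⇒≤ 2+g≤x)
  row : Covers (RestrictedSumset g B) (splitMin x g 0) (splitMax x n₂ e n₂)
  row = splits-cover (+-identityʳ g) e+n₂≡g z≤n g≤x ≤-refl
    (λ i _ i<n₂ → touching-left (≤-trans (s≤s i<n₂) n₂<g) (≤-trans (<⇒≤ 2+g≤x) (m≤n+m x i)) i<n₂)

private
  3h+3≤k⇒3g+5≤x+n₂ : ∀ {g x n₂} → 3 * suc g + 3 ≤ suc (x + n₂) → 3 * g + 5 ≤ x + n₂
  3h+3≤k⇒3g+5≤x+n₂ {g} {x} {n₂} le = ≤-pred (subst (_≤ suc (x + n₂)) (normalise g) le)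
    where
    normalise : ∀ g → 3 * suc g + 3 ≡ suc (3 * g + 5)
    normalise = solve-∀

  x≤1+g⇒2+g≤n₂ : ∀ {g x n₂} → x ≤ suc g → 3 * g + 5 ≤ x + n₂ → 2 + g ≤ n₂
  x≤1+g⇒2+g≤n₂ {g} {x} {n₂} x≤1+g le =
    +-cancelˡ-≤ (suc g) _ _ (≤-trans (m+o≡n⇒m≤n (g + 2) (rearrange g)) (≤-trans le (+-monoˡ-≤ n₂ x≤1+g)))
    where
    rearrange : ∀ g → suc g + (2 + g) + (g + 2) ≡ 3 * g + 5
    rearrange = solve-∀

  n₂≤g⇒2+g≤x : ∀ {g x n₂} → n₂ ≤ g → 3 * g + 5 ≤ x + n₂ → 2 + g ≤ x
  n₂≤g⇒2+g≤x {g} {x} {n₂} n₂≤g le =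
    +-cancelʳ-≤ g _ _ (≤-trans (m+o≡n⇒m≤n (g + 3) (rearrange g)) (≤-trans le (+-monoʳ-≤ x n₂≤g)))
    where
    rearrange : ∀ g → 2 + g + g + (g + 3) ≡ 3 * g + 5
    rearrange = solve-∀

  x≤k∸3⇒x<k : ∀ {x k} → 3 ≤ k → x ≤ k ∸ 3 → x < k
  x≤k∸3⇒x<k {x} {k} 3≤k x≤ =
    ≤-trans (m≤m+n (suc x) 2) (subst (_≤ k) (+-suc x 2) (m≤o∸n⇒m+n≤o x 3≤k x≤))

  m≤m+n∸o⇒o≤n : ∀ {m n o} → o ≤ m + n → m ≤ m + n ∸ o → o ≤ n
  m≤m+n∸o⇒o≤n {m} o≤m+n m≤ = +-cancelˡ-≤ m _ _ (m≤o∸n⇒m+n≤o m o≤m+n m≤)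

  m≡m+n∸o⇒n≡o : ∀ {m n o} → o ≤ m + n → m ≡ m + n ∸ o → n ≡ o
  m≡m+n∸o⇒n≡o {m} {n} {o} o≤m+n m≡ =
    +-cancelˡ-≡ m n o (trans (sym (m∸n+n≡m o≤m+n)) (cong (_+ o) (sym m≡)))

  1+m+n∸o≤m⇒n<o : ∀ {m n o} → suc (m + n) ∸ o ≤ m → n < o
  1+m+n∸o≤m⇒n<o {m} {n} {o} ≤m = +-cancelˡ-≤ m _ _ (subst₂ _≤_ (sym (+-suc m n)) (+-comm o m)
    (≤-trans (m≤n+m∸n (suc (m + n)) o) (+-monoʳ-≤ o ≤m)))

proposition2p4 : (h k x : ℕ) → 3 ≤ h → 3 * h + 3 ≤ k → 1 ≤ x → x ≤ k ∸ 3 →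
    ((x ≤ h ∸ 1 → HasCard (RestrictedSumset h (Aset k x)) (h * k ∸ h * h + x + 2))
    × ((x ≡ h ⊎ x ≡ k ∸ h) → HasCard (RestrictedSumset h (Aset k x)) (h * k ∸ h * h + h + 1))
    × (h + 1 ≤ x → x ≤ k ∸ h ∸ 1 → HasCard (RestrictedSumset h (Aset k x)) (h * k ∸ h * h + h + 2))
    × (k ∸ (h ∸ 1) ≤ x → HasCard (RestrictedSumset h (Aset k x)) ((h + 1) * k ∸ h * h ∸ x + 2)))
proposition2p4 (suc g) k x (s≤s 2≤g) 3h+3≤k 1≤x x≤k∸3
  with m≤n⇒∃[o]m+o≡n (x≤k∸3⇒x<k (≤-trans (m≤n+m 3 (3 * suc g)) 3h+3≤k) x≤k∸3)
... | n₂ , refl =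
    (λ x≤g → card-small-x 1≤x x≤g (x≤1+g⇒2+g≤n₂ (m≤n⇒m≤1+n x≤g) room))
  , [ (λ x≡h → card-x≡h x≡h 2≤g (x≤1+g⇒2+g≤n₂ (≤-reflexive x≡h) room))
    , (λ x≡k∸h → let n₂≡g = m≡m+n∸o⇒n≡o (≤-trans (n≤1+n g) 1+g≤x+n₂) x≡k∸h
                 in card-x≡k∸h n₂≡g 2≤g (n₂≤g⇒2+g≤x (≤-reflexive n₂≡g) room)) ]′
  , (λ h+1≤x x≤k∸h∸1 → card-middle-x 2≤g (subst (_≤ x) (+-comm (suc g) 1) h+1≤x)
      (subst (_≤ n₂) (+-comm g 1) (m≤m+n∸o⇒o≤n (subst (_≤ x + n₂) (+-comm 1 g) 1+g≤x+n₂)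
        (subst (x ≤_) (∸-+-assoc (x + n₂) g 1) x≤k∸h∸1))))
  , (λ k∸g≤x → let n₂<g = 1+m+n∸o≤m⇒n<o k∸g≤x
               in card-large-x (≤-trans (s≤s z≤n) 2≤n₂) n₂<g (n₂≤g⇒2+g≤x (<⇒≤ n₂<g) room))
  where
  room : 3 * g + 5 ≤ x + n₂
  room = 3h+3≤k⇒3g+5≤x+n₂ {x = x} 3h+3≤k
  2+g≤x+n₂ : 2 + g ≤ x + n₂
  2+g≤x+n₂ = ≤-trans (m+o≡n⇒m≤n (2 * g + 3) (rearrange g)) room
    where
    rearrange : ∀ g → 2 + g + (2 * g + 3) ≡ 3 * g + 5
    rearrange = solve-∀
  1+g≤x+n₂ = ≤-trans (n≤1+n _) 2+g≤x+n₂
  2≤n₂ = m≤m+n∸o⇒o≤n (≤-trans (m≤m+n 2 g) 2+g≤x+n₂) x≤k∸3
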